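{- Let $p_{\mathbb{C}}:\mathbb{C}\to\mathbb{B}$, $p_{\mathbb{D}}:\mathbb{D}\to\mathbb{B}$, $q:\mathbb{E}\to\mathbb{B}$ be Grothendieck fibrations, let $\chi:\mathbb{D}\to\mathbb{E}$ and $\rho:\mathbb{C}\to\mathbb{E}$ be fibred functors over $\mathbb{B}$, and let $\rho^\ast(\chi):\mathbb{C}\times_{\mathbb{E}}\mathbb{D}\to\mathbb{C}$ be the projection from the strict pullback of categories. If $\chi$ creates cartesian lifts, then so does $\rho^\ast(\chi)$.
   Context: $\mathbb{C}\times_{\mathbb{E}}\mathbb{D}$ is fibred over $\mathbb{B}$ via the common composite. For a fibration, $\operatorname{Cart}(-)$ denotes the wide subcategory of cartesian maps. A fibred functor $\chi$ creates cartesian lifts if $\operatorname{Cart}(\chi):\operatorname{Cart}(\mathbb{D})\to\operatorname{Cart}(\mathbb{E})$ is a discrete fibration, i.e. for every object $D$ and every cartesian map $u:X'\to\chi(D)$ there is a unique cartesian map $\tilde u$ with codomain $D$ and $\chi(\tilde u)=u$. -}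

module Defs where

open import Level using (Level; _⊔_) renaming (suc to lsuc)
open import Relation.Binary.PropositionalEquality
open import Data.Product using (Σ; Σ-syntax; _×_; _,_)
open import Axiom.UniquenessOfIdentityProofs.WithK using (uip)

private variable
  o₁ h₁ o₂ h₂ o₃ h₃ o₄ h₄ : Level

record Category (o h : Level) : Set (lsuc (o ⊔ h)) where
  infixr 9 _∘_
  field
    Obj       : Set o
    Hom       : Obj → Obj → Set h
    id        : ∀ {A} → Hom A A
    _∘_       : ∀ {A B C} → Hom B C → Hom A B → Hom A C
    identityˡ : ∀ {A B} {f : Hom A B} → id ∘ f ≡ f
    identityʳ : ∀ {A B} {f : Hom A B} → f ∘ id ≡ f
    assoc     : ∀ {A B C D} {f : Hom A B} {g : Hom B C} {h : Hom C D} →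
                (h ∘ g) ∘ f ≡ h ∘ (g ∘ f)

record Functor (C : Category o₁ h₁) (D : Category o₂ h₂) : Set (o₁ ⊔ h₁ ⊔ o₂ ⊔ h₂) where
  private
    module C = Category C
    module D = Category D
  field
    F₀            : C.Obj → D.Obj
    F₁            : ∀ {A B} → C.Hom A B → D.Hom (F₀ A) (F₀ B)
    identity      : ∀ {A} → F₁ (C.id {A}) ≡ D.id
    homomorphism  : ∀ {A B C'} {f : C.Hom A B} {g : C.Hom B C'} →
                    F₁ (g C.∘ f) ≡ F₁ g D.∘ F₁ f

open Functor public

_∘F_ : {C : Category o₁ h₁} {D : Category o₂ h₂} {E : Category o₃ h₃} →
       Functor D E → Functor C D → Functor C E
_∘F_ {C = C} {D} {E} G F = record
  { F₀ = λ x → F₀ G (F₀ F x)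
  ; F₁ = λ f → F₁ G (F₁ F f)
  ; identity = trans (cong (F₁ G) (identity F)) (identity G)
  ; homomorphism = trans (cong (F₁ G) (homomorphism F)) (homomorphism G)
  }

-- "F maps f to u":  F(f) = u  (as arrows, so including F(dom f) = dom u)
MapsTo : {C : Category o₁ h₁} {D : Category o₂ h₂} (F : Functor C D) →
         let module C = Category C ; module D = Category D in
         ∀ {X Y X'} → C.Hom X Y → D.Hom X' (F₀ F Y) → Set (o₂ ⊔ h₂)
MapsTo {D = D} F {X} {Y} {X'} f u =
  Σ[ e ∈ F₀ F X ≡ X' ] subst (λ Z → Category.Hom D Z (F₀ F Y)) e (F₁ F f) ≡ u

IsCartesian : {E : Category o₁ h₁} {B : Category o₂ h₂} (p : Functor E B) →
              ∀ {X Y} → Category.Hom E X Y → Set (o₁ ⊔ h₁ ⊔ h₂)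
IsCartesian {E = E} {B} p {X} {Y} f =
  ∀ {Z} (g : E.Hom Z Y) (h : B.Hom (F₀ p Z) (F₀ p X)) →
  F₁ p f B.∘ h ≡ F₁ p g →
  Σ[ k ∈ E.Hom Z X ] ((F₁ p k ≡ h × f E.∘ k ≡ g) ×
                       (∀ (k' : E.Hom Z X) → F₁ p k' ≡ h → f E.∘ k' ≡ g → k' ≡ k))
  where module E = Category E
        module B = Category B

IsFibration : {E : Category o₁ h₁} {B : Category o₂ h₂} (p : Functor E B) →
              Set (o₁ ⊔ h₁ ⊔ o₂ ⊔ h₂)
IsFibration {E = E} {B} p =
  ∀ {I} (Y : Category.Obj E) (u : Category.Hom B I (F₀ p Y)) →
  Σ[ X ∈ Category.Obj E ] Σ[ f ∈ Category.Hom E X Y ]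
    (IsCartesian p f × MapsTo p f u)

record IsFibredFunctor {B : Category o₁ h₁} {D : Category o₂ h₂} {E : Category o₃ h₃}
       (pD : Functor D B) (q : Functor E B) (χ : Functor D E)
       : Set (o₁ ⊔ h₁ ⊔ o₂ ⊔ h₂ ⊔ o₃ ⊔ h₃) where
  field
    over₀ : ∀ d → F₀ q (F₀ χ d) ≡ F₀ pD d
    over₁ : ∀ {d d'} (f : Category.Hom D d d') →
            subst₂ (Category.Hom B) (over₀ d) (over₀ d') (F₁ q (F₁ χ f)) ≡ F₁ pD f
    preservesCartesian : ∀ {d d'} (f : Category.Hom D d d') →
            IsCartesian pD f → IsCartesian q (F₁ χ f)

-- χ creates cartesian lifts: Cart(χ) : Cart(𝔻) → Cart(𝔼) is a discrete fibration
CreatesCartesianLifts : {B : Category o₁ h₁} {D : Category o₂ h₂} {E : Category o₃ h₃}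
       (pD : Functor D B) (pE : Functor E B) (χ : Functor D E) →
       Set (h₁ ⊔ o₂ ⊔ h₂ ⊔ o₃ ⊔ h₃)
CreatesCartesianLifts {D = D} {E} pD pE χ =
  ∀ (d : D.Obj) {X' : E.Obj} (u : E.Hom X' (F₀ χ d)) → IsCartesian pE u →
  Σ[ X ∈ D.Obj ] Σ[ ũ ∈ D.Hom X d ]
    ((IsCartesian pD ũ × MapsTo χ ũ u) ×
     (∀ (X₂ : D.Obj) (ũ₂ : D.Hom X₂ d) → IsCartesian pD ũ₂ → MapsTo χ ũ₂ u →
        _≡_ {A = Σ D.Obj (λ Z → D.Hom Z d)} (X₂ , ũ₂) (X , ũ)))
  where module D = Category D
        module E = Category E

module _ {C : Category o₁ h₁} {D : Category o₂ h₂} {E : Category o₃ h₃}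
         (ρ : Functor C E) (χ : Functor D E) where
  private
    module C = Category C
    module D = Category D
    module E = Category E

  record PObj : Set (o₁ ⊔ o₂ ⊔ o₃) where
    constructor pobj
    field
      objC : C.Obj
      objD : D.Obj
      eq   : F₀ ρ objC ≡ F₀ χ objD
  open PObj

  record PHom (x y : PObj) : Set (h₁ ⊔ h₂ ⊔ h₃) where
    constructor phom
    field
      homC : C.Hom (objC x) (objC y)
      homD : D.Hom (objD x) (objD y)
      coh  : subst₂ E.Hom (eq x) (eq y) (F₁ ρ homC) ≡ F₁ χ homD
  open PHom

  private
    subst₂-id : ∀ {a b} (e : a ≡ b) → subst₂ E.Hom e e (E.id {a}) ≡ E.id
    subst₂-id refl = refl

    subst₂-∘ : ∀ {a a' b b' c c'} (ea : a ≡ a') (eb : b ≡ b') (ec : c ≡ c')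
               (g : E.Hom b c) (f : E.Hom a b) →
               subst₂ E.Hom ea ec (g E.∘ f) ≡ subst₂ E.Hom eb ec g E.∘ subst₂ E.Hom ea eb f
    subst₂-∘ refl refl refl g f = refl

    phom-≡ : ∀ {x y} {f f' : C.Hom (objC x) (objC y)} {g g' : D.Hom (objD x) (objD y)}
             {p : subst₂ E.Hom (eq x) (eq y) (F₁ ρ f) ≡ F₁ χ g}
             {p' : subst₂ E.Hom (eq x) (eq y) (F₁ ρ f') ≡ F₁ χ g'} →
             f ≡ f' → g ≡ g' → phom f g p ≡ phom f' g' p'
    phom-≡ {p = p} {p'} refl refl = cong (phom _ _) (uip p p')

    pid : ∀ {x} → PHom x x
    pid {x} = phom C.id D.id
      (trans (cong (subst₂ E.Hom (eq x) (eq x)) (identity ρ))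
      (trans (subst₂-id (eq x)) (sym (identity χ))))

    pcomp : ∀ {x y z} → PHom y z → PHom x y → PHom x z
    pcomp {x} {y} {z} (phom f g p) (phom f' g' p') = phom (f C.∘ f') (g D.∘ g')
      (trans (cong (subst₂ E.Hom (eq x) (eq z)) (homomorphism ρ))
      (trans (subst₂-∘ (eq x) (eq y) (eq z) (F₁ ρ f) (F₁ ρ f'))
      (trans (cong₂ E._∘_ p p') (sym (homomorphism χ)))))

  Pullback : Category (o₁ ⊔ o₂ ⊔ o₃) (h₁ ⊔ h₂ ⊔ h₃)
  Pullback = record
    { Obj = PObj
    ; Hom = PHom
    ; id = pid
    ; _∘_ = pcomp
    ; identityˡ = phom-≡ C.identityˡ D.identityˡ
    ; identityʳ = phom-≡ C.identityʳ D.identityʳ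
    ; assoc = phom-≡ C.assoc D.assoc
    }

  pullbackProj : Functor Pullback C
  pullbackProj = record
    { F₀ = objC
    ; F₁ = homC
    ; identity = refl
    ; homomorphism = refl
    }

{-# OPTIONS --safe #-}
-- A lift of the cartesian u : a → c at an object (c , d , e : ρc ≡ χd) of the pullback
-- pairs u with the χ-created lift of the q-cartesian map ρ(u), transported along e. It
-- is cartesian because both components are, and two factorisations lying over the same
-- base map are automatically coherent since χ preserves cartesian maps. Any other
-- cartesian lift of u differs from it by a vertical isomorphism, so its 𝔻-component is
-- again cartesian and χ maps it to ρ(u); uniqueness of created lifts (and UIP for the
-- coherence data) then identifies the two lifts.
module Submission where

open import Level using (Level; _⊔_)
open import Data.Product using (Σ; Σ-syntax; _×_; _,_; proj₁; proj₂)
open import Relation.Binary.PropositionalEquality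
open import Axiom.UniquenessOfIdentityProofs.WithK using (uip)
open import Defs

private variable
  o h o' h' o'' h'' : Level

-- Morphisms with their endpoints, so that maps between different (but propositionally
-- equal) objects can be compared without explicit transports.
record Arrow (𝒞 : Category o h) : Set (o ⊔ h) where
  constructor arrow
  open Category 𝒞
  field
    {dom cod} : Obj
    hom       : Hom dom cod

arr : (𝒞 : Category o h) → ∀ {a b} → Category.Hom 𝒞 a b → Arrow 𝒞
arr 𝒞 f = arrow f

module _ {𝒞 : Category o h} where
  open Category 𝒞

  arr-injective : ∀ {a b} {f g : Hom a b} → arr 𝒞 f ≡ arr 𝒞 g → f ≡ g
  arr-injective refl = refl

  arr-subst₂ : ∀ {a b a' b'} (r : a ≡ a') (s : b ≡ b') (f : Hom a b) →
               arr 𝒞 (subst₂ Hom r s f) ≡ arr 𝒞 f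
  arr-subst₂ refl refl f = refl

  arr≡⇒subst₂≡ : ∀ {a b a' b'} {f : Hom a b} {f' : Hom a' b'} → arr 𝒞 f ≡ arr 𝒞 f' →
                 (r : a ≡ a') (s : b ≡ b') → subst₂ Hom r s f ≡ f'
  arr≡⇒subst₂≡ {f = f} f≈f' r s = arr-injective (trans (arr-subst₂ r s f) f≈f')

  arr-∘ : ∀ {a b c a' b' c'} {g : Hom b c} {g' : Hom b' c'} {f : Hom a b} {f' : Hom a' b'} →
          arr 𝒞 g ≡ arr 𝒞 g' → arr 𝒞 f ≡ arr 𝒞 f' → arr 𝒞 (g ∘ f) ≡ arr 𝒞 (g' ∘ f')
  arr-∘ refl refl = refl

module _ {𝒞 : Category o h} {𝒟 : Category o' h'} (F : Functor 𝒞 𝒟) where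
  private
    module 𝒞 = Category 𝒞
    module 𝒟 = Category 𝒟

  arr-F₁ : ∀ {a b a' b'} {f : 𝒞.Hom a b} {f' : 𝒞.Hom a' b'} →
           arr 𝒞 f ≡ arr 𝒞 f' → arr 𝒟 (F₁ F f) ≡ arr 𝒟 (F₁ F f')
  arr-F₁ refl = refl

  arr≡⇒MapsTo : ∀ {X Y X'} {f : 𝒞.Hom X Y} {u : 𝒟.Hom X' (F₀ F Y)} →
                arr 𝒟 (F₁ F f) ≡ arr 𝒟 u → MapsTo F f u
  arr≡⇒MapsTo refl = refl , refl

  MapsTo⇒arr≡ : ∀ {X Y X'} {f : 𝒞.Hom X Y} {u : 𝒟.Hom X' (F₀ F Y)} →
                MapsTo F f u → arr 𝒟 (F₁ F f) ≡ arr 𝒟 u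
  MapsTo⇒arr≡ (refl , refl) = refl

module _ {ℬ : Category o h} {𝒟 : Category o' h'} {ℰ : Category o'' h''}
         {pD : Functor 𝒟 ℬ} {q : Functor ℰ ℬ} {χ : Functor 𝒟 ℰ} where

  fibred-arr : IsFibredFunctor pD q χ → ∀ {d d'} (f : Category.Hom 𝒟 d d') →
               arr ℬ (F₁ q (F₁ χ f)) ≡ arr ℬ (F₁ pD f)
  fibred-arr fχ f =
    trans (sym (arr-subst₂ (over₀ _) (over₀ _) (F₁ q (F₁ χ f)))) (cong (arr ℬ) (over₁ f))
    where open IsFibredFunctor fχ

module CreatedLift {ℬ : Category o h} {𝒟 : Category o' h'} {ℰ : Category o'' h''}
    (pD : Functor 𝒟 ℬ) (q : Functor ℰ ℬ) (χ : Functor 𝒟 ℰ)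
    (creates : CreatesCartesianLifts pD q χ) (d : Category.Obj 𝒟)
    {X' : Category.Obj ℰ} (u : Category.Hom ℰ X' (F₀ χ d)) (cu : IsCartesian q u) where
  private
    module 𝒟 = Category 𝒟

  lifted-obj : 𝒟.Obj
  lifted-obj = proj₁ (creates d u cu)

  lifted : 𝒟.Hom lifted-obj d
  lifted = proj₁ (proj₂ (creates d u cu))

  lifted-cartesian : IsCartesian pD lifted
  lifted-cartesian = proj₁ (proj₁ (proj₂ (proj₂ (creates d u cu))))

  lifted-over : MapsTo χ lifted u
  lifted-over = proj₂ (proj₁ (proj₂ (proj₂ (creates d u cu))))

  lifted-unique : ∀ d₂ (v₂ : 𝒟.Hom d₂ d) → IsCartesian pD v₂ → MapsTo χ v₂ u →
                  _≡_ {A = Σ 𝒟.Obj (λ Z → 𝒟.Hom Z d)} (d₂ , v₂) (lifted-obj , lifted)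
  lifted-unique = proj₂ (proj₂ (proj₂ (creates d u cu)))

module _ {ℰ : Category o h} {ℬ : Category o' h'} (p : Functor ℰ ℬ) where
  private
    module ℰ = Category ℰ
    module ℬ = Category ℬ
  open ≡-Reasoning

  module CartesianFactor {X Y Z} {f : ℰ.Hom X Y} (cf : IsCartesian p f)
                         (g : ℰ.Hom Z Y) (k : ℬ.Hom (F₀ p Z) (F₀ p X))
                         (fk≡g : F₁ p f ℬ.∘ k ≡ F₁ p g) where
    factor : ℰ.Hom Z X
    factor = proj₁ (cf g k fk≡g)

    factor-over : F₁ p factor ≡ k
    factor-over = proj₁ (proj₁ (proj₂ (cf g k fk≡g)))

    factor-commutes : f ℰ.∘ factor ≡ g
    factor-commutes = proj₂ (proj₁ (proj₂ (cf g k fk≡g)))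

    factor-unique : ∀ k' → F₁ p k' ≡ k → f ℰ.∘ k' ≡ g → k' ≡ factor
    factor-unique = proj₂ (proj₂ (cf g k fk≡g))

  cartesian-subst₂ : ∀ {X Y X' Y'} (r : X ≡ X') (s : Y ≡ Y') {f : ℰ.Hom X Y} →
                     IsCartesian p f → IsCartesian p (subst₂ ℰ.Hom r s f)
  cartesian-subst₂ refl refl cf = cf

  cartesian-factor-unique : ∀ {X Y Z} {f : ℰ.Hom X Y} {k k' : ℰ.Hom Z X} → IsCartesian p f →
                            F₁ p k ≡ F₁ p k' → f ℰ.∘ k ≡ f ℰ.∘ k' → k ≡ k'
  cartesian-factor-unique {f = f} {k} {k'} cf pk≡pk' fk≡fk' =
    trans (K.factor-unique k pk≡pk' fk≡fk') (sym (K.factor-unique k' refl refl))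
    where module K = CartesianFactor cf (f ℰ.∘ k') (F₁ p k') (sym (homomorphism p))

  cartesian-endo-id : ∀ {X Y} {f : ℰ.Hom X Y} {k : ℰ.Hom X X} → IsCartesian p f →
                      F₁ p k ≡ ℬ.id → f ℰ.∘ k ≡ f → k ≡ ℰ.id
  cartesian-endo-id cf pk≡id fk≡f =
    cartesian-factor-unique cf (trans pk≡id (sym (identity p))) (trans fk≡f (sym ℰ.identityʳ))

  cartesian-round-trip : ∀ {X X₂ Y} {f : ℰ.Hom X Y} {f₂ : ℰ.Hom X₂ Y} {m : ℰ.Hom X₂ X}
    {m' : ℰ.Hom X X₂} {a b} → IsCartesian p f → F₁ p m ≡ a → F₁ p m' ≡ b →
    f ℰ.∘ m ≡ f₂ → f₂ ℰ.∘ m' ≡ f → a ℬ.∘ b ≡ ℬ.id → m ℰ.∘ m' ≡ ℰ.id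
  cartesian-round-trip {f = f} {f₂} {m} {m'} {a} {b} cf pm≡a pm'≡b fm≡f₂ f₂m'≡f ab≡id =
    cartesian-endo-id cf
      (begin
        F₁ p (m ℰ.∘ m')      ≡⟨ homomorphism p ⟩
        F₁ p m ℬ.∘ F₁ p m'   ≡⟨ cong₂ ℬ._∘_ pm≡a pm'≡b ⟩
        a ℬ.∘ b              ≡⟨ ab≡id ⟩
        ℬ.id                 ∎)
      (begin
        f ℰ.∘ (m ℰ.∘ m')     ≡⟨ sym ℰ.assoc ⟩
        (f ℰ.∘ m) ℰ.∘ m'     ≡⟨ cong (ℰ._∘ m') fm≡f₂ ⟩
        f₂ ℰ.∘ m'            ≡⟨ f₂m'≡f ⟩
        f                    ∎)

  cartesian-comparison : ∀ {X X₂ Y} {f : ℰ.Hom X Y} {f₂ : ℰ.Hom X₂ Y} →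
    IsCartesian p f → IsCartesian p f₂ →
    (a : ℬ.Hom (F₀ p X₂) (F₀ p X)) (b : ℬ.Hom (F₀ p X) (F₀ p X₂)) →
    a ℬ.∘ b ≡ ℬ.id → b ℬ.∘ a ≡ ℬ.id → F₁ p f ℬ.∘ a ≡ F₁ p f₂ → F₁ p f₂ ℬ.∘ b ≡ F₁ p f →
    Σ[ m ∈ ℰ.Hom X₂ X ] Σ[ m' ∈ ℰ.Hom X X₂ ]
      (f ℰ.∘ m ≡ f₂ × m ℰ.∘ m' ≡ ℰ.id × m' ℰ.∘ m ≡ ℰ.id)
  cartesian-comparison {f = f} {f₂} cf cf₂ a b ab≡id ba≡id fa≡f₂ f₂b≡f =
    M.factor , M'.factor , M.factor-commutes ,
    cartesian-round-trip cf M.factor-over M'.factor-over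
      M.factor-commutes M'.factor-commutes ab≡id ,
    cartesian-round-trip cf₂ M'.factor-over M.factor-over
      M'.factor-commutes M.factor-commutes ba≡id
    where
      module M = CartesianFactor cf f₂ a fa≡f₂
      module M' = CartesianFactor cf₂ f b f₂b≡f

  cartesian-∘-iso : ∀ {X X₂ Y} {f : ℰ.Hom X Y} → IsCartesian p f →
                    (m : ℰ.Hom X₂ X) (m' : ℰ.Hom X X₂) → m ℰ.∘ m' ≡ ℰ.id → m' ℰ.∘ m ≡ ℰ.id →
                    IsCartesian p (f ℰ.∘ m)
  cartesian-∘-iso {f = f} cf m m' mm'≡id m'm≡id g k fmk≡g =
    m' ℰ.∘ K.factor , (over , commutes) , unique
    where
      module K = CartesianFactor cf g (F₁ p m ℬ.∘ k)
        (trans (sym ℬ.assoc) (trans (cong (ℬ._∘ k) (sym (homomorphism p))) fmk≡g))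

      over : F₁ p (m' ℰ.∘ K.factor) ≡ k
      over = begin
        F₁ p (m' ℰ.∘ K.factor)         ≡⟨ homomorphism p ⟩
        F₁ p m' ℬ.∘ F₁ p K.factor      ≡⟨ cong (F₁ p m' ℬ.∘_) K.factor-over ⟩
        F₁ p m' ℬ.∘ (F₁ p m ℬ.∘ k)     ≡⟨ sym ℬ.assoc ⟩
        (F₁ p m' ℬ.∘ F₁ p m) ℬ.∘ k     ≡⟨ cong (ℬ._∘ k) (sym (homomorphism p)) ⟩
        F₁ p (m' ℰ.∘ m) ℬ.∘ k          ≡⟨ cong (λ i → F₁ p i ℬ.∘ k) m'm≡id ⟩
        F₁ p ℰ.id ℬ.∘ k                ≡⟨ cong (ℬ._∘ k) (identity p) ⟩
        ℬ.id ℬ.∘ k                     ≡⟨ ℬ.identityˡ ⟩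
        k                              ∎

      commutes : (f ℰ.∘ m) ℰ.∘ (m' ℰ.∘ K.factor) ≡ g
      commutes = begin
        (f ℰ.∘ m) ℰ.∘ (m' ℰ.∘ K.factor)  ≡⟨ ℰ.assoc ⟩
        f ℰ.∘ (m ℰ.∘ (m' ℰ.∘ K.factor))  ≡⟨ cong (f ℰ.∘_) (sym ℰ.assoc) ⟩
        f ℰ.∘ ((m ℰ.∘ m') ℰ.∘ K.factor)  ≡⟨ cong (λ i → f ℰ.∘ (i ℰ.∘ K.factor)) mm'≡id ⟩
        f ℰ.∘ (ℰ.id ℰ.∘ K.factor)        ≡⟨ cong (f ℰ.∘_) ℰ.identityˡ ⟩
        f ℰ.∘ K.factor                   ≡⟨ K.factor-commutes ⟩
        g                                ∎

      unique : ∀ k' → F₁ p k' ≡ k → (f ℰ.∘ m) ℰ.∘ k' ≡ g → k' ≡ m' ℰ.∘ K.factor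
      unique k' pk'≡k fmk'≡g = begin
        k'                     ≡⟨ sym ℰ.identityˡ ⟩
        ℰ.id ℰ.∘ k'            ≡⟨ cong (ℰ._∘ k') (sym m'm≡id) ⟩
        (m' ℰ.∘ m) ℰ.∘ k'      ≡⟨ ℰ.assoc ⟩
        m' ℰ.∘ (m ℰ.∘ k')      ≡⟨ cong (m' ℰ.∘_) (K.factor-unique (m ℰ.∘ k')
                                    (trans (homomorphism p) (cong (F₁ p m ℬ.∘_) pk'≡k))
                                    (trans (sym ℰ.assoc) fmk'≡g)) ⟩
        m' ℰ.∘ K.factor        ∎

module _ {𝒞 : Category o h} {𝒟 : Category o' h'} {ℰ : Category o'' h''}
         {ρ : Functor 𝒞 ℰ} {χ : Functor 𝒟 ℰ} where
  private
    module ℰ = Category ℰ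
  open PObj
  open PHom

  phom-≡ : ∀ {x y : PObj ρ χ} {f f' : Category.Hom 𝒞 (objC x) (objC y)}
           {g g' : Category.Hom 𝒟 (objD x) (objD y)}
           {c : subst₂ ℰ.Hom (eq x) (eq y) (F₁ ρ f) ≡ F₁ χ g}
           {c' : subst₂ ℰ.Hom (eq x) (eq y) (F₁ ρ f') ≡ F₁ χ g'} →
           f ≡ f' → g ≡ g' → phom {ρ = ρ} {χ} f g c ≡ phom f' g' c'
  phom-≡ {c = c} {c'} refl refl = cong (phom _ _) (uip c c')

  phom-arr : ∀ {x y : PObj ρ χ} (φ : PHom ρ χ x y) → arr ℰ (F₁ ρ (homC φ)) ≡ arr ℰ (F₁ χ (homD φ))
  phom-arr {x} {y} φ = trans (sym (arr-subst₂ (eq x) (eq y) (F₁ ρ (homC φ)))) (cong (arr ℰ) (coh φ))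

module _ {ob hb oc hc od hd oe he : Level}
    {B : Category ob hb} {C : Category oc hc} {D : Category od hd} {E : Category oe he}
    {pC : Functor C B} {pD : Functor D B} {q : Functor E B}
    {χ : Functor D E} {ρ : Functor C E}
    (fχ : IsFibredFunctor pD q χ) (fρ : IsFibredFunctor pC q ρ) where
  private
    module B = Category B
    module C = Category C
    module D = Category D
    module E = Category E
    module P = Category (Pullback ρ χ)
    π = pullbackProj ρ χ
    p = pC ∘F π
  open PObj
  open PHom
  open ≡-Reasoning

  fibres-agree : (x : PObj ρ χ) → F₀ pC (objC x) ≡ F₀ pD (objD x)
  fibres-agree x = trans (sym (IsFibredFunctor.over₀ fρ (objC x)))
                         (trans (cong (F₀ q) (eq x)) (IsFibredFunctor.over₀ fχ (objD x)))

  bases-agree : ∀ {x y} (φ : PHom ρ χ x y) → arr B (F₁ pC (homC φ)) ≡ arr B (F₁ pD (homD φ))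
  bases-agree φ = begin
    arr B (F₁ pC (homC φ))          ≡⟨ sym (fibred-arr fρ (homC φ)) ⟩
    arr B (F₁ q (F₁ ρ (homC φ)))    ≡⟨ arr-F₁ q (phom-arr φ) ⟩
    arr B (F₁ q (F₁ χ (homD φ)))    ≡⟨ fibred-arr fχ (homD φ) ⟩
    arr B (F₁ pD (homD φ))          ∎

  pairing-coherent : ∀ {x y z} (φ : PHom ρ χ x y) (ψ : PHom ρ χ z y) → IsCartesian pD (homD φ) →
    (kC : C.Hom (objC z) (objC x)) (kD : D.Hom (objD z) (objD x)) →
    arr B (F₁ pC kC) ≡ arr B (F₁ pD kD) → homC φ C.∘ kC ≡ homC ψ → homD φ D.∘ kD ≡ homD ψ →
    subst₂ E.Hom (eq z) (eq x) (F₁ ρ kC) ≡ F₁ χ kD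
  pairing-coherent {x} {z = z} φ ψ cartD kC kD same-base φkC≡ψ φkD≡ψ =
    cartesian-factor-unique q (IsFibredFunctor.preservesCartesian fχ (homD φ) cartD)
      (arr-injective over) (arr-injective commutes)
    where
      k : E.Hom (F₀ χ (objD z)) (F₀ χ (objD x))
      k = subst₂ E.Hom (eq z) (eq x) (F₁ ρ kC)

      over : arr B (F₁ q k) ≡ arr B (F₁ q (F₁ χ kD))
      over = begin
        arr B (F₁ q k)              ≡⟨ arr-F₁ q (arr-subst₂ (eq z) (eq x) (F₁ ρ kC)) ⟩
        arr B (F₁ q (F₁ ρ kC))      ≡⟨ fibred-arr fρ kC ⟩
        arr B (F₁ pC kC)            ≡⟨ same-base ⟩
        arr B (F₁ pD kD)            ≡⟨ sym (fibred-arr fχ kD) ⟩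
        arr B (F₁ q (F₁ χ kD))      ∎

      commutes : arr E (F₁ χ (homD φ) E.∘ k) ≡ arr E (F₁ χ (homD φ) E.∘ F₁ χ kD)
      commutes = begin
        arr E (F₁ χ (homD φ) E.∘ k)              ≡⟨ arr-∘ (sym (phom-arr φ))
                                                          (arr-subst₂ (eq z) (eq x) (F₁ ρ kC)) ⟩
        arr E (F₁ ρ (homC φ) E.∘ F₁ ρ kC)        ≡⟨ cong (arr E) (sym (homomorphism ρ)) ⟩
        arr E (F₁ ρ (homC φ C.∘ kC))             ≡⟨ cong (λ i → arr E (F₁ ρ i)) φkC≡ψ ⟩
        arr E (F₁ ρ (homC ψ))                    ≡⟨ phom-arr ψ ⟩
        arr E (F₁ χ (homD ψ))                    ≡⟨ cong (λ i → arr E (F₁ χ i)) (sym φkD≡ψ) ⟩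
        arr E (F₁ χ (homD φ D.∘ kD))             ≡⟨ cong (arr E) (homomorphism χ) ⟩
        arr E (F₁ χ (homD φ) E.∘ F₁ χ kD)        ∎

  pullback-cartesian : ∀ {x y} (φ : PHom ρ χ x y) →
    IsCartesian pC (homC φ) → IsCartesian pD (homD φ) → IsCartesian p φ
  pullback-cartesian {x} φ cartC cartD {z} ψ k φk≡ψ =
    phom KC.factor KD.factor coherent ,
    (KC.factor-over , phom-≡ KC.factor-commutes KD.factor-commutes) ,
    unique
    where
      k' : B.Hom (F₀ pD (objD z)) (F₀ pD (objD x))
      k' = subst₂ B.Hom (fibres-agree z) (fibres-agree x) k

      k≈k' : arr B k ≡ arr B k'
      k≈k' = sym (arr-subst₂ (fibres-agree z) (fibres-agree x) k)

      φk'≡ψ : F₁ pD (homD φ) B.∘ k' ≡ F₁ pD (homD ψ)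
      φk'≡ψ = arr-injective (begin
        arr B (F₁ pD (homD φ) B.∘ k')   ≡⟨ arr-∘ (sym (bases-agree φ)) (sym k≈k') ⟩
        arr B (F₁ pC (homC φ) B.∘ k)    ≡⟨ cong (arr B) φk≡ψ ⟩
        arr B (F₁ pC (homC ψ))          ≡⟨ bases-agree ψ ⟩
        arr B (F₁ pD (homD ψ))          ∎)

      module KC = CartesianFactor pC cartC (homC ψ) k φk≡ψ
      module KD = CartesianFactor pD cartD (homD ψ) k' φk'≡ψ

      coherent : subst₂ E.Hom (eq z) (eq x) (F₁ ρ KC.factor) ≡ F₁ χ KD.factor
      coherent = pairing-coherent φ ψ cartD KC.factor KD.factor
        (trans (cong (arr B) KC.factor-over) (trans k≈k' (cong (arr B) (sym KD.factor-over))))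
        KC.factor-commutes KD.factor-commutes

      unique : ∀ κ → F₁ p κ ≡ k → φ P.∘ κ ≡ ψ → κ ≡ phom KC.factor KD.factor coherent
      unique κ pκ≡k φκ≡ψ = phom-≡
        (KC.factor-unique (homC κ) pκ≡k (cong homC φκ≡ψ))
        (KD.factor-unique (homD κ)
          (arr-injective (trans (sym (bases-agree κ)) (trans (cong (arr B) pκ≡k) k≈k')))
          (cong homD φκ≡ψ))

  homD-cartesian-transfer : ∀ {a d d₂ e e₂ y}
    (φ : PHom ρ χ (pobj a d e) y) (ψ : PHom ρ χ (pobj a d₂ e₂) y) →
    IsCartesian p φ → IsCartesian p ψ → F₁ pC (homC φ) ≡ F₁ pC (homC ψ) →
    IsCartesian pD (homD φ) → IsCartesian pD (homD ψ)
  homD-cartesian-transfer φ ψ cφ cψ same-base cartD =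
    let m , m' , φm≡ψ , mm'≡id , m'm≡id = cartesian-comparison p cφ cψ B.id B.id
          B.identityˡ B.identityˡ (trans B.identityʳ same-base) (trans B.identityʳ (sym same-base))
    in subst (IsCartesian pD) (cong homD φm≡ψ)
         (cartesian-∘-iso pD cartD (homD m) (homD m') (cong homD mm'≡id) (cong homD m'm≡id))

  pullback-lift-≡ : ∀ {y : PObj ρ χ} {a u d₀ d₂ v₀ v₂ e₀ e₂ c₀ c₂} →
    _≡_ {A = Σ D.Obj (λ Z → D.Hom Z (objD y))} (d₂ , v₂) (d₀ , v₀) →
    _≡_ {A = Σ (PObj ρ χ) (λ Z → PHom ρ χ Z y)}
      (pobj a d₂ e₂ , phom u v₂ c₂) (pobj a d₀ e₀ , phom u v₀ c₀)
  pullback-lift-≡ {a = a} {u} {d₀} {v₀ = v₀} {e₀ = e₀} {e₂} {c₀} {c₂} refl with uip e₂ e₀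
  ... | refl = cong (λ c → pobj a d₀ e₀ , phom u v₀ c) (uip c₂ c₀)

  pullback-creates-cartesian-lifts : CreatesCartesianLifts pD q χ → CreatesCartesianLifts p pC π
  pullback-creates-cartesian-lifts creates y {a} u cu =
    lift-obj , lift , (lift-cartesian , refl , refl) , lift-unique
    where
      ρu : E.Hom (F₀ ρ a) (F₀ χ (objD y))
      ρu = subst₂ E.Hom refl (eq y) (F₁ ρ u)

      module V = CreatedLift pD q χ creates (objD y) ρu
        (cartesian-subst₂ q refl (eq y) (IsFibredFunctor.preservesCartesian fρ u cu))

      ρu≈χv : arr E (F₁ ρ u) ≡ arr E (F₁ χ V.lifted)
      ρu≈χv = trans (sym (arr-subst₂ refl (eq y) (F₁ ρ u))) (sym (MapsTo⇒arr≡ χ V.lifted-over))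

      lift-obj : PObj ρ χ
      lift-obj = pobj a V.lifted-obj (sym (proj₁ V.lifted-over))

      lift : PHom ρ χ lift-obj y
      lift = phom u V.lifted (arr≡⇒subst₂≡ ρu≈χv _ _)

      lift-cartesian : IsCartesian p lift
      lift-cartesian = pullback-cartesian lift cu V.lifted-cartesian

      lift-unique : ∀ x₂ (ψ : PHom ρ χ x₂ y) → IsCartesian p ψ → MapsTo π ψ u →
                    _≡_ {A = Σ (PObj ρ χ) (λ Z → PHom ρ χ Z y)} (x₂ , ψ) (lift-obj , lift)
      lift-unique (pobj _ d₂ _) ψ@(phom _ v₂ _) cψ (refl , refl) =
        pullback-lift-≡ (V.lifted-unique d₂ v₂ v₂-cartesian v₂-over)
        where
          v₂-cartesian : IsCartesian pD v₂
          v₂-cartesian =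
            homD-cartesian-transfer lift ψ lift-cartesian cψ refl V.lifted-cartesian

          v₂-over : MapsTo χ v₂ ρu
          v₂-over = arr≡⇒MapsTo χ
            (trans (sym (phom-arr ψ)) (sym (arr-subst₂ refl (eq y) (F₁ ρ u))))

mainTheorem19 : ∀ {ob hb oc hc od hd oe he : Level}
    {B : Category ob hb} {C : Category oc hc} {D : Category od hd} {E : Category oe he}
    (pC : Functor C B) (pD : Functor D B) (q : Functor E B)
    (χ : Functor D E) (ρ : Functor C E) →
    IsFibration pC → IsFibration pD → IsFibration q →
    IsFibredFunctor pD q χ → IsFibredFunctor pC q ρ →
    CreatesCartesianLifts pD q χ →
    CreatesCartesianLifts (pC ∘F pullbackProj ρ χ) pC (pullbackProj ρ χ)
mainTheorem19 _ _ _ _ _ _ _ _ fχ fρ = pullback-creates-cartesian-lifts fχ fρ
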